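{- Let $K=\mathbb{Q}(\sqrt{5})$, $O_K$ its ring of integers, $u=\frac{1+\sqrt{5}}{2}$, and let $p\geq 11$ be a prime. Let $(a,b,c)$ be a triple of nonzero, pairwise-jointly coprime (i.e. with no prime ideal of $O_K$ dividing all three) elements of $O_K$ with $a^p+b^p+c^p=0$. Then, after possibly permuting $a,b,c$ and multiplying $(a,b,c)$ by a suitable unit of $O_K$, one of the following two conditions holds: (1) $2$ divides $a$, $2$ does not divide $bc$, and $b$ is a square modulo $4$ (i.e. $b\equiv x^2 \pmod{4O_K}$ for some $x\in O_K$); (2) $2$ does not divide $abc$ and the pair $(a^p,b^p)$ is congruent modulo $4O_K$ to one of the pairs $(u,1+2u)$, $(3,u^2)$, $(1,u)$, $(1,u^2+2u)$.
   Context: Divisibility and congruences are taken in $O_K$. Throughout the relevant part of the paper $p$ is assumed to be a prime $\geq 11$. -}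

module Defs where

open import Level using (0ℓ)
open import Data.Nat as ℕ using (ℕ; zero; suc)
open import Data.Integer as ℤ using (ℤ; +_; -[1+_])
open import Data.Product using (Σ; ∃; _×_; _,_)
open import Data.Sum using (_⊎_)
open import Relation.Nullary using (¬_)
open import Relation.Binary.PropositionalEquality using (_≡_)

-- O_K = ℤ[u], u = (1+√5)/2, u² = u + 1.
-- The element ⟨ x , y ⟩ represents x + y·u.
record O : Set where
  constructor ⟨_,_⟩
  field
    re : ℤ
    im : ℤ
open O public

infixl 6 _+O_ _-O_
infixl 7 _*O_

_+O_ : O → O → O
⟨ a , b ⟩ +O ⟨ c , d ⟩ = ⟨ a ℤ.+ c , b ℤ.+ d ⟩

-O_ : O → O
-O ⟨ a , b ⟩ = ⟨ ℤ.- a , ℤ.- b ⟩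

_-O_ : O → O → O
x -O y = x +O (-O y)

-- (a + b u)(c + d u) = (ac + bd) + (ad + bc + bd) u, using u² = u + 1
_*O_ : O → O → O
⟨ a , b ⟩ *O ⟨ c , d ⟩ =
  ⟨ a ℤ.* c ℤ.+ b ℤ.* d , a ℤ.* d ℤ.+ b ℤ.* c ℤ.+ b ℤ.* d ⟩

ι : ℤ → O
ι n = ⟨ n , + 0 ⟩

0O 1O 2O 3O 4O uO : O
0O = ι (+ 0)
1O = ι (+ 1)
2O = ι (+ 2)
3O = ι (+ 3)
4O = ι (+ 4)
uO = ⟨ + 0 , + 1 ⟩

_^O_ : O → ℕ → O
x ^O zero  = 1O
x ^O suc n = x *O (x ^O n)

_∣O_ : O → O → Set
d ∣O x = ∃ λ k → x ≡ d *O k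

_≡_[modO_] : O → O → O → Set
x ≡ y [modO m ] = m ∣O (x -O y)

IsUnit : O → Set
IsUnit e = ∃ λ v → e *O v ≡ 1O

record IsIdeal (P : O → Set) : Set where
  field
    zero∈ : P 0O
    +-closed : ∀ {x y} → P x → P y → P (x +O y)
    *-closed : ∀ r {x} → P x → P (r *O x)

record IsPrimeIdeal (P : O → Set) : Set where
  field
    ideal    : IsIdeal P
    nonzero  : ∃ λ x → (¬ x ≡ 0O) × P x
    proper   : ¬ P 1O
    prime    : ∀ x y → P (x *O y) → P x ⊎ P y

-- a prime ideal P "divides" x iff x ∈ P.
-- jointly coprime: no prime ideal contains (divides) all three
JointlyCoprime : O → O → O → Set₁
JointlyCoprime a b c =
  ∀ (P : O → Set) → IsPrimeIdeal P → ¬ (P a × P b × P c)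

IsPerm3 : O → O → O → O → O → O → Set
IsPerm3 a' b' c' a b c =
     (a' ≡ a × b' ≡ b × c' ≡ c)
  ⊎ (a' ≡ a × b' ≡ c × c' ≡ b)
  ⊎ (a' ≡ b × b' ≡ a × c' ≡ c)
  ⊎ (a' ≡ b × b' ≡ c × c' ≡ a)
  ⊎ (a' ≡ c × b' ≡ a × c' ≡ b)
  ⊎ (a' ≡ c × b' ≡ b × c' ≡ a)

Cond1 : O → O → O → Set
Cond1 a b c =
  (2O ∣O a) × ¬ (2O ∣O (b *O c)) × (∃ λ x → b ≡ x *O x [modO 4O ])

PairCong : O → O → O → O → Set
PairCong x y s t = (x ≡ s [modO 4O ]) × (y ≡ t [modO 4O ])

Cond2 : ℕ → O → O → O → Set
Cond2 p a b c =
  ¬ (2O ∣O (a *O b *O c)) ×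
  (  PairCong (a ^O p) (b ^O p) uO (1O +O 2O *O uO)
   ⊎ PairCong (a ^O p) (b ^O p) 3O (uO *O uO)
   ⊎ PairCong (a ^O p) (b ^O p) 1O uO
   ⊎ PairCong (a ^O p) (b ^O p) 1O (uO *O uO +O 2O *O uO))

module Submission where

-- Everything in the theorem is a statement about classes modulo 4O_K, so the
-- proof takes place in the finite ring O_K/4O_K ≅ (ℤ/4)², whose elements we
-- call residues.
-- This yields that (2) is a prime ideal of O_K, so a coprime triple is not
-- entirely even.  Next, the residue of x^p only depends on p modulo 6
-- (x⁸ ≡ x² mod 4), and a prime p ≥ 11 is 5 or 7 modulo 6.  For exponents 5
-- and 7, a decision procedure checks over all residue triples that every
-- solution of r^e + s^e + t^e ≡ 0 that is not entirely even can be brought,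
-- by one of the units ±uᵏ and a permutation, to condition (1) or (2).

open import Defs
open import Data.Nat as ℕ using (ℕ; zero; suc; _≥_; _<_; _≤_; z≤n; s≤s)
import Data.Nat.Properties as ℕP
import Data.Nat.Divisibility as ℕD
open import Data.Nat.DivMod using (_%_; _/_; m≡m%n+[m/n]*n; m%n<n)
open import Data.Nat.Primality using (Prime; prime⇒irreducible)
open import Data.Fin using (Fin; toℕ) renaming (zero to 0F; suc to 1+F)
open import Data.Fin.Properties using (all?; any?) renaming (_≟_ to _≟F_)
open import Data.Integer as ℤ using (ℤ; +_)
import Data.Integer.DivMod as ℤD
open import Data.Integer.Divisibility.Signed
  using (_∣_; divides; _∣?_; ∣-trans; ∣m∣n⇒∣m+n; ∣m∣n⇒∣m-n; ∣m⇒∣-m; ∣n⇒∣m*n; ∣m⇒∣m*n)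
open import Data.Integer.Tactic.RingSolver using (solve-∀)
open import Data.Sign using (Sign)
open import Data.Product using (Σ; ∃; _×_; _,_; proj₁; proj₂)
open import Data.Product.Properties using (≡-dec)
open import Data.Sum as Sum using (_⊎_; inj₁; inj₂)
open import Data.Empty using (⊥-elim)
open import Data.List using (List; []; _∷_; upTo; cartesianProduct; cartesianProductWith)
open import Data.List.Relation.Unary.Any as Any using (Any) renaming (any? to anyList?)
open import Relation.Nullary using (¬_; Dec)
open import Relation.Nullary.Decidable using (map′; _×-dec_; _⊎-dec_; _→-dec_; ¬?; toWitness)
open import Relation.Binary.PropositionalEquality
  using (_≡_; refl; sym; trans; cong; cong₂; subst; module ≡-Reasoning)

-- i ≡ j (mod m); a record rather than an abbreviation so that i, j, m can be
-- inferred from a proof.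
infix 4 _≡_[mod_]
record _≡_[mod_] (i j m : ℤ) : Set where
  constructor congruent
  field difference : m ∣ i ℤ.- j
open _≡_[mod_]

module _ {m : ℤ} where

  mod-sym : ∀ {i j} → i ≡ j [mod m ] → j ≡ i [mod m ]
  mod-sym {i} {j} (congruent h) = congruent (subst (m ∣_) (negate i j) (∣m⇒∣-m h))
    where
    negate : ∀ i j → ℤ.- (i ℤ.- j) ≡ j ℤ.- i
    negate = solve-∀

  mod-trans : ∀ {i j k} → i ≡ j [mod m ] → j ≡ k [mod m ] → i ≡ k [mod m ]
  mod-trans {i} {j} {k} (congruent h) (congruent h′) =
    congruent (subst (m ∣_) (telescope i j k) (∣m∣n⇒∣m+n h h′))
    where
    telescope : ∀ i j k → (i ℤ.- j) ℤ.+ (j ℤ.- k) ≡ i ℤ.- k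
    telescope = solve-∀

  mod-+ : ∀ {i i′ j j′} → i ≡ i′ [mod m ] → j ≡ j′ [mod m ] →
          i ℤ.+ j ≡ i′ ℤ.+ j′ [mod m ]
  mod-+ {i} {i′} {j} {j′} (congruent h) (congruent h′) =
    congruent (subst (m ∣_) (regroup i i′ j j′) (∣m∣n⇒∣m+n h h′))
    where
    regroup : ∀ i i′ j j′ → (i ℤ.- i′) ℤ.+ (j ℤ.- j′) ≡ (i ℤ.+ j) ℤ.- (i′ ℤ.+ j′)
    regroup = solve-∀

  mod-* : ∀ {i i′ j j′} → i ≡ i′ [mod m ] → j ≡ j′ [mod m ] →
          i ℤ.* j ≡ i′ ℤ.* j′ [mod m ]
  mod-* {i} {i′} {j} {j′} (congruent h) (congruent h′) =
    congruent (subst (m ∣_) (regroup i i′ j j′) (∣m∣n⇒∣m+n (∣n⇒∣m*n i h′) (∣m⇒∣m*n j′ h)))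
    where
    regroup : ∀ i i′ j j′ →
      i ℤ.* (j ℤ.- j′) ℤ.+ (i ℤ.- i′) ℤ.* j′ ≡ i ℤ.* j ℤ.- i′ ℤ.* j′
    regroup = solve-∀

even-mod4 : ∀ {i j} → + 2 ∣ i → i ≡ j [mod + 4 ] → + 2 ∣ j
even-mod4 {i} {j} 2∣i (congruent 4∣i-j) =
  subst (+ 2 ∣_) (cancel i j) (∣m∣n⇒∣m-n 2∣i (∣-trans (divides (+ 2) refl) 4∣i-j))
  where
  cancel : ∀ i j → i ℤ.- (i ℤ.- j) ≡ j
  cancel = solve-∀

-- ℤ/4, represented by the least non-negative representatives 0, 1, 2, 3.
Z₄ : Set
Z₄ = Fin 4

toℤ : Z₄ → ℤ
toℤ a = + toℕ a

fromRemainder : ℕ → Z₄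
fromRemainder 0 = 0F
fromRemainder 1 = 1+F 0F
fromRemainder 2 = 1+F (1+F 0F)
fromRemainder _ = 1+F (1+F (1+F 0F))

toℤ-fromRemainder : ∀ n → n < 4 → toℤ (fromRemainder n) ≡ + n
toℤ-fromRemainder 0 _ = refl
toℤ-fromRemainder 1 _ = refl
toℤ-fromRemainder 2 _ = refl
toℤ-fromRemainder 3 _ = refl
toℤ-fromRemainder (suc (suc (suc (suc _)))) (s≤s (s≤s (s≤s (s≤s ()))))

reduce : ℤ → Z₄
reduce i = fromRemainder (i ℤD.%ℕ 4)

representative-unique : ∀ a b → toℤ a ≡ toℤ b [mod + 4 ] → a ≡ b
representative-unique = toWitness {a? = all? λ a → all? λ b →
  map′ congruent difference (+ 4 ∣? toℤ a ℤ.- toℤ b) →-dec (a ≟F b)} _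

reduce-sound : ∀ i → i ≡ toℤ (reduce i) [mod + 4 ]
reduce-sound i = congruent (divides (i ℤD./ℕ 4)
  (subst (λ r → i ℤ.- r ≡ i ℤD./ℕ 4 ℤ.* + 4) (sym (toℤ-fromRemainder (i ℤD.%ℕ 4) (ℤD.n%ℕd<d i 4)))
    (trans (cong (ℤ._- + (i ℤD.%ℕ 4)) (ℤD.a≡a%ℕn+[a/ℕn]*n i 4))
           (quotient-part (+ (i ℤD.%ℕ 4)) (i ℤD./ℕ 4)))))
  where
  quotient-part : ∀ r q → (r ℤ.+ q ℤ.* + 4) ℤ.- r ≡ q ℤ.* + 4
  quotient-part = solve-∀

reduce-cong : ∀ {i j} → i ≡ j [mod + 4 ] → reduce i ≡ reduce j
reduce-cong {i} {j} i≡j = representative-unique (reduce i) (reduce j)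
  (mod-trans (mod-sym (reduce-sound i)) (mod-trans i≡j (reduce-sound j)))

ι-divides : ∀ {n x} → n ∣ re x → n ∣ im x → ι n ∣O x
ι-divides {n} (divides s a≡sn) (divides t b≡tn) =
  ⟨ s , t ⟩ , cong₂ ⟨_,_⟩ (trans a≡sn (re-part n s t)) (trans b≡tn (im-part n s t))
  where
  re-part : ∀ n s t → s ℤ.* n ≡ n ℤ.* s ℤ.+ + 0 ℤ.* t
  re-part = solve-∀
  im-part : ∀ n s t → t ℤ.* n ≡ n ℤ.* t ℤ.+ + 0 ℤ.* s ℤ.+ + 0 ℤ.* t
  im-part = solve-∀

ι-divides⁻¹ : ∀ {n x} → ι n ∣O x → n ∣ re x × n ∣ im x
ι-divides⁻¹ {n} (⟨ s , t ⟩ , refl) =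
  divides s (re-part n s t) , divides t (im-part n s t)
  where
  re-part : ∀ n s t → n ℤ.* s ℤ.+ + 0 ℤ.* t ≡ s ℤ.* n
  re-part = solve-∀
  im-part : ∀ n s t → n ℤ.* t ℤ.+ + 0 ℤ.* s ℤ.+ + 0 ℤ.* t ≡ t ℤ.* n
  im-part = solve-∀

ι-ideal : ∀ n → IsIdeal (ι n ∣O_)
ι-ideal n = record
  { zero∈    = ι-divides {n} {0O} (divides (+ 0) refl) (divides (+ 0) refl)
  ; +-closed = λ {x} {y} x∈ y∈ →
      let (n∣a , n∣b) = ι-divides⁻¹ {n} {x} x∈ ; (n∣c , n∣d) = ι-divides⁻¹ {n} {y} y∈
      in ι-divides {n} {x +O y} (∣m∣n⇒∣m+n n∣a n∣c) (∣m∣n⇒∣m+n n∣b n∣d)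
  ; *-closed = λ r {x} x∈ →
      let (n∣a , n∣b) = ι-divides⁻¹ {n} {x} x∈
      in ι-divides {n} {r *O x} (∣m∣n⇒∣m+n (∣n⇒∣m*n (re r) n∣a) (∣n⇒∣m*n (im r) n∣b))
                   (∣m∣n⇒∣m+n (∣m∣n⇒∣m+n (∣n⇒∣m*n (re r) n∣b) (∣n⇒∣m*n (im r) n∣a))
                              (∣n⇒∣m*n (im r) n∣b))
  }

*O-assoc : ∀ x y z → (x *O y) *O z ≡ x *O (y *O z)
*O-assoc ⟨ a , b ⟩ ⟨ c , d ⟩ ⟨ e , f ⟩ =
  cong₂ ⟨_,_⟩ (re-part a b c d e f) (im-part a b c d e f)
  where
  re-part : ∀ a b c d e f →
    (a ℤ.* c ℤ.+ b ℤ.* d) ℤ.* e ℤ.+ (a ℤ.* d ℤ.+ b ℤ.* c ℤ.+ b ℤ.* d) ℤ.* f ≡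
    a ℤ.* (c ℤ.* e ℤ.+ d ℤ.* f) ℤ.+ b ℤ.* (c ℤ.* f ℤ.+ d ℤ.* e ℤ.+ d ℤ.* f)
  re-part = solve-∀
  im-part : ∀ a b c d e f →
    (a ℤ.* c ℤ.+ b ℤ.* d) ℤ.* f ℤ.+ (a ℤ.* d ℤ.+ b ℤ.* c ℤ.+ b ℤ.* d) ℤ.* e
      ℤ.+ (a ℤ.* d ℤ.+ b ℤ.* c ℤ.+ b ℤ.* d) ℤ.* f ≡
    a ℤ.* (c ℤ.* f ℤ.+ d ℤ.* e ℤ.+ d ℤ.* f) ℤ.+ b ℤ.* (c ℤ.* e ℤ.+ d ℤ.* f)
      ℤ.+ b ℤ.* (c ℤ.* f ℤ.+ d ℤ.* e ℤ.+ d ℤ.* f)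
  im-part = solve-∀

*O-identityˡ : ∀ x → 1O *O x ≡ x
*O-identityˡ ⟨ a , b ⟩ = cong₂ ⟨_,_⟩ (re-part a b) (im-part a b)
  where
  re-part : ∀ a b → + 1 ℤ.* a ℤ.+ + 0 ℤ.* b ≡ a
  re-part = solve-∀
  im-part : ∀ a b → + 1 ℤ.* b ℤ.+ + 0 ℤ.* a ℤ.+ + 0 ℤ.* b ≡ b
  im-part = solve-∀

unit-* : ∀ {x y} → IsUnit x → IsUnit y → IsUnit (x *O y)
unit-* {x} {y} (x′ , xx′≡1) (y′ , yy′≡1) = y′ *O x′ , (begin
  (x *O y) *O (y′ *O x′)   ≡⟨ *O-assoc x y (y′ *O x′) ⟩
  x *O (y *O (y′ *O x′))   ≡⟨ cong (x *O_) (sym (*O-assoc y y′ x′)) ⟩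
  x *O ((y *O y′) *O x′)   ≡⟨ cong (λ z → x *O (z *O x′)) yy′≡1 ⟩
  x *O (1O *O x′)          ≡⟨ cong (x *O_) (*O-identityˡ x′) ⟩
  x *O x′                  ≡⟨ xx′≡1 ⟩
  1O                       ∎)
  where open ≡-Reasoning

unit-^ : ∀ {x} → IsUnit x → ∀ n → IsUnit (x ^O n)
unit-^ _  zero    = 1O , refl
unit-^ {x} ux (suc n) = unit-* {x} {x ^O n} ux (unit-^ ux n)

u-unit : IsUnit uO
u-unit = ⟨ ℤ.- + 1 , + 1 ⟩ , refl

sign-unit : ∀ s → IsUnit (ι (s ℤ.◃ 1))
sign-unit Sign.- = ι (ℤ.- + 1) , refl
sign-unit Sign.+ = 1O , refl

-- The units ±uᵏ, k < 6, among which a normalising unit is searched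
-- (u⁶ ≡ 1 mod 4, so higher powers give nothing new).
units : List (Σ O IsUnit)
units = cartesianProductWith signedPowerOfU (Sign.+ ∷ Sign.- ∷ []) (upTo 6)
  where
  signedPowerOfU : Sign → ℕ → Σ O IsUnit
  signedPowerOfU s k = ι (s ℤ.◃ 1) *O uO ^O k , unit-* {ι (s ℤ.◃ 1)} {uO ^O k} (sign-unit s) (unit-^ u-unit k)

-- O_K/4O_K ≅ (ℤ/4)², a residue being the pair of coordinates modulo 4.
Residue : Set
Residue = Z₄ × Z₄

lift : Residue → O
lift (a , b) = ⟨ toℤ a , toℤ b ⟩

ρ : O → Residue
ρ x = reduce (re x) , reduce (im x)

infixl 6 _⊕_
infixl 7 _⊗_
infixr 8 _^R_
infix  4 _≟R_

_⊕_ _⊗_ : Residue → Residue → Residue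
r ⊕ s = ρ (lift r +O lift s)
r ⊗ s = ρ (lift r *O lift s)

_^R_ : Residue → ℕ → Residue
r ^R zero  = ρ 1O
r ^R suc n = r ⊗ r ^R n

_≟R_ : (r s : Residue) → Dec (r ≡ s)
_≟R_ = ≡-dec _≟F_ _≟F_

allR? : {P : Residue → Set} → (∀ r → Dec (P r)) → Dec (∀ r → P r)
allR? P? = map′ (λ h (a , b) → h a b) (λ h a b → h (a , b))
                (all? λ a → all? λ b → P? (a , b))

anyR? : {P : Residue → Set} → (∀ r → Dec (P r)) → Dec (∃ P)
anyR? P? = map′ (λ (a , b , h) → (a , b) , h) (λ ((a , b) , h) → a , b , h)
                (any? λ a → any? λ b → P? (a , b))

-- Coordinatewise congruence modulo 4; it is respected by +O and *O because
-- their coordinates are integer polynomials in the coordinates.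
infix 4 _≈₄_
_≈₄_ : O → O → Set
x ≈₄ y = re x ≡ re y [mod + 4 ] × im x ≡ im y [mod + 4 ]

≈₄-sym : ∀ {x y} → x ≈₄ y → y ≈₄ x
≈₄-sym (a , b) = mod-sym a , mod-sym b

≈₄-trans : ∀ {x y z} → x ≈₄ y → y ≈₄ z → x ≈₄ z
≈₄-trans (a , b) (c , d) = mod-trans a c , mod-trans b d

≈₄-+ : ∀ {x x′ y y′} → x ≈₄ x′ → y ≈₄ y′ → x +O y ≈₄ x′ +O y′
≈₄-+ (a , b) (c , d) = mod-+ a c , mod-+ b d

≈₄-* : ∀ {x x′ y y′} → x ≈₄ x′ → y ≈₄ y′ → x *O y ≈₄ x′ *O y′
≈₄-* (a , b) (c , d) = mod-+ (mod-* a c) (mod-* b d) ,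
                       mod-+ (mod-+ (mod-* a d) (mod-* b c)) (mod-* b d)

ρ-sound : ∀ x → x ≈₄ lift (ρ x)
ρ-sound x = reduce-sound (re x) , reduce-sound (im x)

ρ-cong : ∀ {x y} → x ≈₄ y → ρ x ≡ ρ y
ρ-cong (a , b) = cong₂ _,_ (reduce-cong a) (reduce-cong b)

ρ-+ : ∀ x y → ρ (x +O y) ≡ ρ x ⊕ ρ y
ρ-+ x y = ρ-cong (≈₄-+ (ρ-sound x) (ρ-sound y))

ρ-* : ∀ x y → ρ (x *O y) ≡ ρ x ⊗ ρ y
ρ-* x y = ρ-cong (≈₄-* (ρ-sound x) (ρ-sound y))

ρ-^ : ∀ x n → ρ (x ^O n) ≡ ρ x ^R n
ρ-^ x zero    = refl
ρ-^ x (suc n) = trans (ρ-* x (x ^O n)) (cong (ρ x ⊗_) (ρ-^ x n))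

ρ-injective : ∀ {x y} → ρ x ≡ ρ y → x ≡ y [modO 4O ]
ρ-injective {x} {y} ρx≡ρy =
  let (re≡ , im≡) = ≈₄-trans (ρ-sound x) (subst (_≈₄ y) (cong lift (sym ρx≡ρy)) (≈₄-sym (ρ-sound y)))
  in ι-divides {+ 4} {x -O y} (difference re≡) (difference im≡)

Even : Residue → Set
Even (a , b) = + 2 ∣ toℤ a × + 2 ∣ toℤ b

even? : ∀ r → Dec (Even r)
even? (a , b) = (+ 2 ∣? toℤ a) ×-dec (+ 2 ∣? toℤ b)

even-ρ : ∀ {x} → 2O ∣O x → Even (ρ x)
even-ρ {x} 2∣x = let (2∣a , 2∣b) = ι-divides⁻¹ {+ 2} {x} 2∣x ; (a , b) = ρ-sound x
                 in even-mod4 2∣a a , even-mod4 2∣b b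

even-ρ⁻¹ : ∀ {x} → Even (ρ x) → 2O ∣O x
even-ρ⁻¹ {x} (2∣a , 2∣b) = let (a , b) = ρ-sound x
                           in ι-divides {+ 2} {x} (even-mod4 2∣a (mod-sym a)) (even-mod4 2∣b (mod-sym b))

-- ℤ[u]/2 is the field with four elements: no zero divisors modulo 2.
even-product : ∀ r s → Even (r ⊗ s) → Even r ⊎ Even s
even-product = toWitness {a? = allR? λ r → allR? λ s →
  even? (r ⊗ s) →-dec (even? r ⊎-dec even? s)} _

one-odd : ¬ Even (ρ 1O)
one-odd = toWitness {a? = ¬? (even? (ρ 1O))} _

two-prime : IsPrimeIdeal (2O ∣O_)
two-prime = record
  { ideal   = ι-ideal (+ 2)
  ; nonzero = 2O , (λ ()) , 1O , refl
  ; proper  = λ 2∣1 → one-odd (even-ρ {1O} 2∣1)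
  ; prime   = λ x y 2∣xy → Sum.map (even-ρ⁻¹ {x}) (even-ρ⁻¹ {y})
      (even-product (ρ x) (ρ y) (subst Even (ρ-* x y) (even-ρ {x *O y} 2∣xy)))
  }

-- The unit group of O_K/4 has exponent 6 and 2-divisible residues square
-- to zero, so r⁸ = r² for every residue.
eighth-power : ∀ r → r ^R 8 ≡ r ^R 2
eighth-power = toWitness {a? = allR? λ r → r ^R 8 ≟R r ^R 2} _

^R-shift : ∀ r n → 2 ≤ n → r ^R (6 ℕ.+ n) ≡ r ^R n
^R-shift r (suc (suc k)) (s≤s (s≤s z≤n)) = shifted k
  where
  shifted : ∀ k → r ^R (8 ℕ.+ k) ≡ r ^R (2 ℕ.+ k)
  shifted zero    = eighth-power r
  shifted (suc k) = cong (r ⊗_) (shifted k)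

SamePowers : ℕ → ℕ → Set
SamePowers p e = ∀ r → r ^R p ≡ r ^R e

^R-periodic : ∀ q n → 2 ≤ n → SamePowers (q ℕ.* 6 ℕ.+ n) n
^R-periodic zero    n _   r = refl
^R-periodic (suc q) n 2≤n r =
  trans (^R-shift r (q ℕ.* 6 ℕ.+ n) (ℕP.≤-trans 2≤n (ℕP.m≤n+m n (q ℕ.* 6))))
        (^R-periodic q n 2≤n r)

ρ-power : ∀ {p e} → SamePowers p e → ∀ x → ρ (x ^O p) ≡ ρ x ^R e
ρ-power {p} same x = trans (ρ-^ x p) (same (ρ x))

no-proper-divisor : ∀ {p} → Prime p → ∀ d → 1 < d → d < p → ¬ d ℕD.∣ p
no-proper-divisor pp d 1<d d<p d∣p with prime⇒irreducible pp d∣p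
... | inj₁ refl = ℕP.<-irrefl refl 1<d
... | inj₂ refl = ℕP.<-irrefl refl d<p

-- A prime p ≥ 11 is 5 or 7 modulo 6 (written 6q + 7 rather than 6q + 1).
prime-mod-6 : ∀ {p} → Prime p → p ≥ 11 → ∃ λ q → p ≡ q ℕ.* 6 ℕ.+ 5 ⊎ p ≡ q ℕ.* 6 ℕ.+ 7
prime-mod-6 {p} pp p≥11 = by-remainder (p % 6) (p / 6) (m%n<n p 6) (m≡m%n+[m/n]*n p 6)
  where
  excluded : ∀ d → 1 < d → d ℕD.∣ 6 → ∀ {r} q → d ℕD.∣ r → ¬ p ≡ r ℕ.+ q ℕ.* 6
  excluded d 1<d d∣6 q d∣r p≡ =
    no-proper-divisor pp d 1<d (ℕP.<-≤-trans (ℕP.≤-<-trans (ℕD.∣⇒≤ d∣6) (ℕP.<ᵇ⇒< 6 11 _)) p≥11)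
    (subst (d ℕD.∣_) (sym p≡) (ℕD.∣m∣n⇒∣m+n d∣r (ℕD.∣n⇒∣m*n q d∣6)))
  by-remainder : ∀ r q → r < 6 → p ≡ r ℕ.+ q ℕ.* 6 →
                 ∃ λ q → p ≡ q ℕ.* 6 ℕ.+ 5 ⊎ p ≡ q ℕ.* 6 ℕ.+ 7
  by-remainder 0 q _ p≡ = ⊥-elim (excluded 2 (ℕP.<ᵇ⇒< 1 2 _) (ℕD.divides 3 refl) q (ℕD.divides 0 refl) p≡)
  by-remainder 1 zero _ p≡ = ⊥-elim (ℕP.<⇒≱ (ℕP.<ᵇ⇒< 1 11 _) (subst (11 ℕ.≤_) p≡ p≥11))
  by-remainder 1 (suc q) _ p≡ = q , inj₂ (trans p≡ (ℕP.+-comm 7 (q ℕ.* 6)))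
  by-remainder 2 q _ p≡ = ⊥-elim (excluded 2 (ℕP.<ᵇ⇒< 1 2 _) (ℕD.divides 3 refl) q (ℕD.divides 1 refl) p≡)
  by-remainder 3 q _ p≡ = ⊥-elim (excluded 3 (ℕP.<ᵇ⇒< 1 3 _) (ℕD.divides 2 refl) q (ℕD.divides 1 refl) p≡)
  by-remainder 4 q _ p≡ = ⊥-elim (excluded 2 (ℕP.<ᵇ⇒< 1 2 _) (ℕD.divides 3 refl) q (ℕD.divides 2 refl) p≡)
  by-remainder 5 q _ p≡ = q , inj₁ (trans p≡ (ℕP.+-comm 5 (q ℕ.* 6)))
  by-remainder (suc (suc (suc (suc (suc (suc _)))))) _ (s≤s (s≤s (s≤s (s≤s (s≤s (s≤s ())))))) _

Triple : Set → Set
Triple A = A × A × A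

map₃ : {A B : Set} → (A → B) → Triple A → Triple B
map₃ f (a , b , c) = f a , f b , f c

data Perm3 : Set where
  abc acb bac bca cab cba : Perm3

allPerm3 : List Perm3
allPerm3 = abc ∷ acb ∷ bac ∷ bca ∷ cab ∷ cba ∷ []

permute : {A : Set} → Perm3 → Triple A → Triple A
permute abc (a , b , c) = a , b , c
permute acb (a , b , c) = a , c , b
permute bac (a , b , c) = b , a , c
permute bca (a , b , c) = b , c , a
permute cab (a , b , c) = c , a , b
permute cba (a , b , c) = c , b , a

permute-IsPerm3 : ∀ σ a b c → let (a′ , b′ , c′) = permute σ (a , b , c) in IsPerm3 a′ b′ c′ a b c
permute-IsPerm3 abc a b c = inj₁ (refl , refl , refl)
permute-IsPerm3 acb a b c = inj₂ (inj₁ (refl , refl , refl))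
permute-IsPerm3 bac a b c = inj₂ (inj₂ (inj₁ (refl , refl , refl)))
permute-IsPerm3 bca a b c = inj₂ (inj₂ (inj₂ (inj₁ (refl , refl , refl))))
permute-IsPerm3 cab a b c = inj₂ (inj₂ (inj₂ (inj₂ (inj₁ (refl , refl , refl)))))
permute-IsPerm3 cba a b c = inj₂ (inj₂ (inj₂ (inj₂ (inj₂ (refl , refl , refl)))))

permute-map₃ : {A B : Set} (f : A → B) → ∀ σ t → permute σ (map₃ f t) ≡ map₃ f (permute σ t)
permute-map₃ f abc t = refl
permute-map₃ f acb t = refl
permute-map₃ f bac t = refl
permute-map₃ f bca t = refl
permute-map₃ f cab t = refl
permute-map₃ f cba t = refl

Cond1R : Residue → Residue → Residue → Set
Cond1R r s t = Even r × ¬ Even (s ⊗ t) × ∃ λ w → s ≡ w ⊗ w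

cond1R? : ∀ r s t → Dec (Cond1R r s t)
cond1R? r s t = even? r ×-dec ¬? (even? (s ⊗ t)) ×-dec anyR? (λ w → s ≟R w ⊗ w)

PairR : Residue → Residue → O → O → Set
PairR x y s t = x ≡ ρ s × y ≡ ρ t

pairR? : ∀ x y s t → Dec (PairR x y s t)
pairR? x y s t = (x ≟R ρ s) ×-dec (y ≟R ρ t)

Cond2R : ℕ → Residue → Residue → Residue → Set
Cond2R e r s t = ¬ Even (r ⊗ s ⊗ t) ×
  (  PairR (r ^R e) (s ^R e) uO (1O +O 2O *O uO)
   ⊎ PairR (r ^R e) (s ^R e) 3O (uO *O uO)
   ⊎ PairR (r ^R e) (s ^R e) 1O uO
   ⊎ PairR (r ^R e) (s ^R e) 1O (uO *O uO +O 2O *O uO))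

cond2R? : ∀ e r s t → Dec (Cond2R e r s t)
cond2R? e r s t = ¬? (even? (r ⊗ s ⊗ t)) ×-dec
  (   pairR? (r ^R e) (s ^R e) uO (1O +O 2O *O uO)
  ⊎-dec pairR? (r ^R e) (s ^R e) 3O (uO *O uO)
  ⊎-dec pairR? (r ^R e) (s ^R e) 1O uO
  ⊎-dec pairR? (r ^R e) (s ^R e) 1O (uO *O uO +O 2O *O uO))

NormalForm : ℕ → Triple Residue → Set
NormalForm e (r , s , t) = Cond1R r s t ⊎ Cond2R e r s t

normalForm? : ∀ e t → Dec (NormalForm e t)
normalForm? e (r , s , t) = cond1R? r s t ⊎-dec cond2R? e r s t

cond1-ρ : ∀ {x y z} → Cond1R (ρ x) (ρ y) (ρ z) → Cond1 x y z
cond1-ρ {x} {y} {z} (even-x , odd-yz , w , ρy≡w²) =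
  even-ρ⁻¹ {x} even-x ,
  (λ 2∣yz → odd-yz (subst Even (ρ-* y z) (even-ρ {y *O z} 2∣yz))) ,
  lift w , ρ-injective {y} {lift w *O lift w} ρy≡w²

cond2-ρ : ∀ {p e} → SamePowers p e → ∀ {x y z} → Cond2R e (ρ x) (ρ y) (ρ z) → Cond2 p x y z
cond2-ρ {p} {e} same {x} {y} {z} (odd-xyz , pairs) =
  (λ 2∣xyz → odd-xyz (subst Even ρ-xyz (even-ρ {x *O y *O z} 2∣xyz))) ,
  Sum.map (pair uO (1O +O 2O *O uO)) (Sum.map (pair 3O (uO *O uO))
    (Sum.map (pair 1O uO) (pair 1O (uO *O uO +O 2O *O uO)))) pairs
  where
  ρ-xyz : ρ (x *O y *O z) ≡ ρ x ⊗ ρ y ⊗ ρ z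
  ρ-xyz = trans (ρ-* (x *O y) z) (cong (_⊗ ρ z) (ρ-* x y))
  pair : ∀ s t → PairR (ρ x ^R e) (ρ y ^R e) s t → PairCong (x ^O p) (y ^O p) s t
  pair s t (hx , hy) = ρ-injective {x ^O p} {s} (trans (ρ-power same x) hx) ,
                       ρ-injective {y ^O p} {t} (trans (ρ-power same y) hy)

normalForm-ρ : ∀ {p e} → SamePowers p e → ∀ {x y z} →
               NormalForm e (ρ x , ρ y , ρ z) → Cond1 x y z ⊎ Cond2 p x y z
normalForm-ρ same {x} {y} {z} = Sum.map (cond1-ρ {x} {y} {z}) (cond2-ρ same {x} {y} {z})

candidates : List (Perm3 × Σ O IsUnit)
candidates = cartesianProduct allPerm3 units

normalise : Perm3 × Σ O IsUnit → Triple Residue → Triple Residue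
normalise (σ , ε , _) t = map₃ (ρ ε ⊗_) (permute σ t)

Classification : ℕ → Set
Classification e = ∀ r s t → r ^R e ⊕ s ^R e ⊕ t ^R e ≡ ρ 0O →
  ¬ (Even r × Even s × Even t) →
  Any (λ c → NormalForm e (normalise c (r , s , t))) candidates

classification? : ∀ e → Dec (Classification e)
classification? e = allR? λ r → allR? λ s → allR? λ t →
  (r ^R e ⊕ s ^R e ⊕ t ^R e ≟R ρ 0O) →-dec ¬? (even? r ×-dec even? s ×-dec even? t) →-dec
  anyList? (λ c → normalForm? e (normalise c (r , s , t))) candidates

classification-5 : Classification 5
classification-5 = toWitness {a? = classification? 5} _

classification-7 : Classification 7
classification-7 = toWitness {a? = classification? 7} _

exponent-reduction : ∀ {p} → Prime p → p ≥ 11 → ∃ λ e → SamePowers p e × Classification e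
exponent-reduction pp p≥11 = by-class (prime-mod-6 pp p≥11)
  where
  by-class : ∀ {p} → (∃ λ q → p ≡ q ℕ.* 6 ℕ.+ 5 ⊎ p ≡ q ℕ.* 6 ℕ.+ 7) →
             ∃ λ e → SamePowers p e × Classification e
  by-class (q , inj₁ refl) = 5 , ^R-periodic q 5 (ℕP.<ᵇ⇒< 1 5 _) , classification-5
  by-class (q , inj₂ refl) = 7 , ^R-periodic q 7 (ℕP.<ᵇ⇒< 1 7 _) , classification-7

normalise-ρ : ∀ c t → normalise c (map₃ ρ t) ≡ map₃ ρ (let (σ , ε , _) = c in map₃ (ε *O_) (permute σ t))
normalise-ρ (σ , ε , _) t = begin
  map₃ (ρ ε ⊗_) (permute σ (map₃ ρ t))   ≡⟨ cong (map₃ (ρ ε ⊗_)) (permute-map₃ ρ σ t) ⟩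
  map₃ (ρ ε ⊗_) (map₃ ρ (permute σ t))   ≡⟨ sym (scale-ρ (permute σ t)) ⟩
  map₃ ρ (map₃ (ε *O_) (permute σ t))    ∎
  where
  open ≡-Reasoning
  scale-ρ : ∀ t → map₃ ρ (map₃ (ε *O_) t) ≡ map₃ (ρ ε ⊗_) (map₃ ρ t)
  scale-ρ (a , b , c) = cong₂ _,_ (ρ-* ε a) (cong₂ _,_ (ρ-* ε b) (ρ-* ε c))

fermat-sum-ρ : ∀ {p e} → SamePowers p e → ∀ a b c →
  ρ ((a ^O p) +O (b ^O p) +O (c ^O p)) ≡ ρ a ^R e ⊕ ρ b ^R e ⊕ ρ c ^R e
fermat-sum-ρ {p} {e} same a b c = begin
  ρ ((a ^O p) +O (b ^O p) +O (c ^O p))   ≡⟨ ρ-+ ((a ^O p) +O (b ^O p)) (c ^O p) ⟩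
  ρ ((a ^O p) +O (b ^O p)) ⊕ ρ (c ^O p)  ≡⟨ cong (_⊕ ρ (c ^O p)) (ρ-+ (a ^O p) (b ^O p)) ⟩
  ρ (a ^O p) ⊕ ρ (b ^O p) ⊕ ρ (c ^O p)   ≡⟨ cong₂ _⊕_ (cong₂ _⊕_ (ρ-power same a) (ρ-power same b))
                                                     (ρ-power same c) ⟩
  ρ a ^R e ⊕ ρ b ^R e ⊕ ρ c ^R e         ∎
  where open ≡-Reasoning

coprime-not-all-even : ∀ {a b c} → JointlyCoprime a b c → ¬ (Even (ρ a) × Even (ρ b) × Even (ρ c))
coprime-not-all-even {a} {b} {c} coprime (ea , eb , ec) =
  coprime (2O ∣O_) two-prime (even-ρ⁻¹ {a} ea , even-ρ⁻¹ {b} eb , even-ρ⁻¹ {c} ec)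

Normalisable : ℕ → O → O → O → Set
Normalisable p a b c = ∃ λ ε → ∃ λ a' → ∃ λ b' → ∃ λ c' →
  IsUnit ε × IsPerm3 a' b' c' a b c ×
  (Cond1 (ε *O a') (ε *O b') (ε *O c') ⊎ Cond2 p (ε *O a') (ε *O b') (ε *O c'))

normalisable : ∀ {p e} → SamePowers p e → Classification e →
  ∀ a b c → JointlyCoprime a b c → (a ^O p) +O (b ^O p) +O (c ^O p) ≡ 0O →
  Normalisable p a b c
normalisable {p} {e} same classify a b c coprime fermat =
  let sum≡0 = trans (sym (fermat-sum-ρ same a b c)) (cong ρ fermat)
      ((σ , ε , ε-unit) , normal-form) =
        Any.satisfied (classify (ρ a) (ρ b) (ρ c) sum≡0 (coprime-not-all-even coprime))
      (a′ , b′ , c′) = permute σ (a , b , c)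
  in ε , a′ , b′ , c′ , ε-unit , permute-IsPerm3 σ a b c ,
     normalForm-ρ same (subst (NormalForm e) (normalise-ρ (σ , ε , ε-unit) (a , b , c)) normal-form)

mainTheorem4 : (p : ℕ) → Prime p → p ≥ 11 →
    (a b c : O) → ¬ a ≡ 0O → ¬ b ≡ 0O → ¬ c ≡ 0O →
    JointlyCoprime a b c →
    (a ^O p) +O (b ^O p) +O (c ^O p) ≡ 0O →
    ∃ λ ε → ∃ λ a' → ∃ λ b' → ∃ λ c' →
      IsUnit ε × IsPerm3 a' b' c' a b c ×
      (Cond1 (ε *O a') (ε *O b') (ε *O c') ⊎ Cond2 p (ε *O a') (ε *O b') (ε *O c'))
mainTheorem4 p pp p≥11 a b c _ _ _ coprime fermat =
  let (e , same , classify) = exponent-reduction pp p≥11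
  in normalisable same classify a b c coprime fermat
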